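{- Let $m,n$ be nonnegative integers with $m\ge 1$, let $\mathfrak{s}$ be an $m$-star and $\mathfrak{c}$ an $n$-chain (on disjoint ground sets), and let $\mathfrak{S\!C}_{m,n}^{\bullet}$ denote the set of proper mergings of $\mathfrak{s}$ and $\mathfrak{c}$. Then \[ \bigl\lvert\mathfrak{S\!C}_{m,n}^{\bullet}\bigr\rvert=\sum_{k=1}^{n+1} k^{m}(n-k+2)^{m+1}. \]
   Context: Let $(P,\le_P)$ and $(Q,\le_Q)$ be posets on disjoint ground sets. For relations $R\subseteq P\times Q$ and $T\subseteq Q\times P$, define the relation $\le_{R,T}$ on $P\cup Q$ by: $x\le_{R,T} y$ iff $x\le_P y$, or $x\le_Q y$, or $(x,y)\in R$, or $(x,y)\in T$. The pair $(R,T)$ is a merging of $P$ and $Q$ if $\le_{R,T}$ is a quasi-order (reflexive and transitive) on $P\cup Q$; it is a proper merging if in addition $R\cap T^{ -1}=\emptyset$ (equivalently, $\le_{R,T}$ is a partial order). An $m$-star is the poset on $S=\{s_0,s_1,\dots,s_m\}$ with $s\le s'$ iff $s=s'$ or $s=s_0$ (an $m$-element antichain with a least element adjoined). An $n$-chain is the poset on $C=\{c_1,\dots,c_n\}$ with $c_i\le c_j$ iff $i\le j$ (for $n=0$ it is empty). -}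

module Defs where

open import Data.Nat using (ℕ; zero; suc; _+_; _*_; _∸_; _^_; _≤_)
open import Data.Fin using (Fin; toℕ) renaming (zero to fzero)
open import Data.Vec using (Vec; lookup)
open import Data.Bool using (Bool; true)
open import Data.Sum using (_⊎_; inj₁; inj₂)
open import Data.Product using (_×_; Σ; ∃-syntax)
open import Data.List using (List; map; upTo; length)
open import Data.Nat.ListAction using (sum)
open import Data.List.Membership.Propositional using (_∈_)
open import Data.List.Relation.Unary.Unique.Propositional using (Unique)
open import Relation.Binary.PropositionalEquality using (_≡_)
open import Relation.Nullary using (¬_)
open import Function.Bundles using (_⇔_)

-- The m-star on {s_0,...,s_m}, encoded as Fin (suc m) with s_0 = fzero:
-- s ≤ s' iff s = s' or s = s_0.
_≤S_ : {m : ℕ} → Fin (suc m) → Fin (suc m) → Set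
x ≤S y = (x ≡ y) ⊎ (x ≡ fzero)

-- The n-chain on {c_1,...,c_n}, encoded as Fin n (c_{i+1} ↦ i).
_≤C_ : {n : ℕ} → Fin n → Fin n → Set
x ≤C y = toℕ x ≤ toℕ y

Rel : ℕ → ℕ → Set
Rel a b = Vec (Vec Bool b) a

_∋⟨_,_⟩ : {a b : ℕ} → Rel a b → Fin a → Fin b → Set
R ∋⟨ x , y ⟩ = lookup (lookup R x) y ≡ true

Elem : ℕ → ℕ → Set
Elem m n = Fin (suc m) ⊎ Fin n

≤[_,_] : {m n : ℕ} → Rel (suc m) n → Rel n (suc m) → Elem m n → Elem m n → Set
≤[ R , T ] (inj₁ x) (inj₁ y) = x ≤S y
≤[ R , T ] (inj₂ x) (inj₂ y) = x ≤C y
≤[ R , T ] (inj₁ x) (inj₂ y) = R ∋⟨ x , y ⟩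
≤[ R , T ] (inj₂ x) (inj₁ y) = T ∋⟨ x , y ⟩

IsMerging : {m n : ℕ} → Rel (suc m) n → Rel n (suc m) → Set
IsMerging {m} {n} R T =
  ((x : Elem m n) → ≤[ R , T ] x x) ×
  ((x y z : Elem m n) → ≤[ R , T ] x y → ≤[ R , T ] y z → ≤[ R , T ] x z)

IsProperMerging : {m n : ℕ} → Rel (suc m) n × Rel n (suc m) → Set
IsProperMerging {m} {n} (R Data.Product., T) =
  IsMerging R T × ((x : Fin (suc m)) (y : Fin n) → ¬ (R ∋⟨ x , y ⟩ × T ∋⟨ y , x ⟩))

HasCardinality : {A : Set} → (A → Set) → ℕ → Set
HasCardinality {A} P N =
  ∃[ L ] (Unique L × ((a : A) → (a ∈ L) ⇔ P a) × (length {A = A} L ≡ N))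

starChainFormula : ℕ → ℕ → ℕ
starChainFormula m n =
  sum (map (λ k → k ^ m * (n + 2 ∸ k) ^ (suc m)) (map suc (upTo (suc n))))

module Submission where

-- In a merging the chain elements above a star element x form an
-- upset of the chain, and those below x a downset; so the pair (R , T) is
-- determined by two thresholds per star element: x R y iff up x ≤ y, and
-- y T x iff y < low x.  Transitivity and properness of ≤_{R,T} translate
-- into a few inequalities between these thresholds; we call threshold data
-- satisfying them a (valid) cut.  Writing base = low s₀, mids = the vector
-- (up s₀, low s₁, …, low sₘ) and tops = (up s₁, …, up sₘ), a cut is valid iff
-- base lies below every mid, every mid below every top, and all are ≤ n.
-- Cuts are counted by the largest mid t = suc n ∸ k (k = 1, …, n + 1): each
-- top ranges over [t, n] (k choices) and the offsets mids ∸ base range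
-- freely over [0, t] (n + 2 ∸ k choices), base being fixed by max mids = t.

open import Defs
open import Data.Nat using (ℕ; zero; suc; _+_; _*_; _∸_; _^_; _≤_; _<_; _⊔_; _≤ᵇ_; z≤n; s≤s)
open import Data.Nat.Properties
open import Data.Bool using (Bool; true; false)
open import Data.Bool.Properties using (T-≡)
open import Data.Fin using (Fin; toℕ; fromℕ<) renaming (zero to fzero; suc to fsuc)
open import Data.Fin.Properties using (toℕ-fromℕ<)
open import Data.Vec using (Vec; []; _∷_; lookup; tabulate) renaming (map to vmap)
open import Data.Vec.Properties using (lookup-map; lookup∘tabulate; tabulate∘lookup; tabulate-cong; ∷-injectiveˡ; ∷-injectiveʳ)
open import Data.List using (List; []; _∷_; map; upTo; length; _++_)
open import Data.List.Properties using (length-map; length-++; length-upTo)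
open import Data.Nat.ListAction using (sum)
open import Data.List.Membership.Propositional using (_∈_)
open import Data.List.Membership.Propositional.Properties using (∈-map⁺; ∈-map⁻; ∈-++⁺ˡ; ∈-++⁺ʳ; ∈-++⁻; ∈-upTo⁺; ∈-upTo⁻)
open import Data.List.Relation.Unary.Any using (here; there)
open import Data.List.Relation.Unary.All as All using (All; []; _∷_)
open import Data.List.Relation.Unary.AllPairs using ([]; _∷_)
open import Data.List.Relation.Unary.Unique.Propositional using (Unique)
open import Data.List.Relation.Unary.Unique.Propositional.Properties using (++⁺; upTo⁺; Unique[x∷xs]⇒x∉xs) renaming (map⁺ to unique-map⁺)
open import Data.Product using (_×_; _,_; proj₁; proj₂; ∃-syntax; map₁)
open import Data.Sum using (inj₁; inj₂)
open import Data.Empty using (⊥; ⊥-elim)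
open import Function using (_∘_)
open import Function.Bundles using (_⇔_; mk⇔; Equivalence)
open import Relation.Binary.PropositionalEquality using (_≡_; _≢_; refl; sym; trans; cong; cong₂; subst; module ≡-Reasoning)
open import Relation.Nullary using (¬_)

open Equivalence using (to; from)

map-unique : {A B : Set} {P : A → Set} (f : A → B) →
  (∀ {a a'} → P a → P a' → f a ≡ f a' → a ≡ a') →
  ∀ {L} → All P L → Unique L → Unique (map f L)
map-unique {P = P} f injective = go
  where
  fresh : ∀ {a L} → P a → All P L → All (a ≢_) L → All (f a ≢_) (map f L)
  fresh pa [] [] = []
  fresh pa (pb ∷ pL) (a≢b ∷ a∉L) = (λ fa≡fb → a≢b (injective pa pb fa≡fb)) ∷ fresh pa pL a∉L

  go : ∀ {L} → All P L → Unique L → Unique (map f L)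
  go [] [] = []
  go (pa ∷ pL) (a∉L ∷ unique) = fresh pa pL a∉L ∷ go pL unique

HasCardinality-bijection : {A B : Set} {P : A → Set} {Q : B → Set} {N : ℕ} (f : A → B) →
  (∀ {a} → P a → Q (f a)) →
  (∀ {a a'} → P a → P a' → f a ≡ f a' → a ≡ a') →
  (∀ {b} → Q b → ∃[ a ] (P a × f a ≡ b)) →
  HasCardinality P N → HasCardinality Q N
HasCardinality-bijection {P = P} {Q} f preserves injective onto (L , unique , mem , len) =
  map f L ,
  map-unique f injective (All.tabulate (λ {a} a∈L → to (mem a) a∈L)) unique ,
  (λ b → mk⇔ image-in-Q (covered b)) ,
  trans (length-map f L) len
  where
  image-in-Q : ∀ {b} → b ∈ map f L → Q b
  image-in-Q b∈ with ∈-map⁻ f b∈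
  ... | a , a∈L , refl = preserves (to (mem a) a∈L)

  covered : ∀ b → Q b → b ∈ map f L
  covered b qb with onto qb
  ... | a , pa , refl = ∈-map⁺ f (from (mem a) pa)

module _ {K X : Set} {Q : K → X → Set} {N : K → ℕ} (count : ∀ k → HasCardinality (Q k) (N k)) where

  private
    enum : K → List X
    enum k = proj₁ (count k)

    enum-unique : ∀ k → Unique (enum k)
    enum-unique k = proj₁ (proj₂ (count k))

    enum-∈ : ∀ k x → x ∈ enum k ⇔ Q k x
    enum-∈ k = proj₁ (proj₂ (proj₂ (count k)))

    enum-length : ∀ k → length (enum k) ≡ N k
    enum-length k = proj₂ (proj₂ (proj₂ (count k)))

    pairs : List K → List (K × X)
    pairs [] = []
    pairs (k ∷ ks) = map (k ,_) (enum k) ++ pairs ks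

    pairs-∈⁻ : ∀ ks {k x} → (k , x) ∈ pairs ks → k ∈ ks × Q k x
    pairs-∈⁻ (k ∷ ks) p∈ with ∈-++⁻ (map (k ,_) (enum k)) p∈
    ... | inj₂ p∈ks = map₁ there (pairs-∈⁻ ks p∈ks)
    ... | inj₁ p∈k with ∈-map⁻ (k ,_) p∈k
    ...   | x , x∈ , refl = here refl , to (enum-∈ k x) x∈

    pairs-∈⁺ : ∀ ks {k x} → k ∈ ks → Q k x → (k , x) ∈ pairs ks
    pairs-∈⁺ (k ∷ ks) (here refl) q = ∈-++⁺ˡ (∈-map⁺ (k ,_) (from (enum-∈ k _) q))
    pairs-∈⁺ (k ∷ ks) (there k∈ks) q = ∈-++⁺ʳ (map (k ,_) (enum k)) (pairs-∈⁺ ks k∈ks q)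

    pairs-unique : ∀ ks → Unique ks → Unique (pairs ks)
    pairs-unique [] [] = []
    pairs-unique (k ∷ ks) unique@(_ ∷ unique-ks) =
      ++⁺ (unique-map⁺ (cong proj₂) (enum-unique k)) (pairs-unique ks unique-ks) disjoint
      where
      disjoint : ∀ {p} → ¬ (p ∈ map (k ,_) (enum k) × p ∈ pairs ks)
      disjoint (p∈k , p∈ks) with ∈-map⁻ (k ,_) p∈k
      ... | _ , _ , refl = Unique[x∷xs]⇒x∉xs unique (proj₁ (pairs-∈⁻ ks p∈ks))

    pairs-length : ∀ ks → length (pairs ks) ≡ sum (map N ks)
    pairs-length [] = refl
    pairs-length (k ∷ ks) =
      trans (length-++ (map (k ,_) (enum k)))
            (cong₂ _+_ (trans (length-map (k ,_) (enum k)) (enum-length k)) (pairs-length ks))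

  HasCardinality-Σ : (ks : List K) → Unique ks →
    HasCardinality {K × X} (λ p → proj₁ p ∈ ks × Q (proj₁ p) (proj₂ p)) (sum (map N ks))
  HasCardinality-Σ ks unique =
    pairs ks , pairs-unique ks unique ,
    (λ (k , x) → mk⇔ (pairs-∈⁻ ks) (λ (k∈ks , q) → pairs-∈⁺ ks k∈ks q)) ,
    pairs-length ks

sum-const : {A : Set} (c : ℕ) (L : List A) → sum (map (λ _ → c) L) ≡ length L * c
sum-const c [] = refl
sum-const c (_ ∷ L) = cong (c +_) (sum-const c L)

-- Products: a dependent sum with constant fibres.
HasCardinality-× : {A B : Set} {P : A → Set} {Q : B → Set} {NP NQ : ℕ} →
  HasCardinality P NP → HasCardinality Q NQ →
  HasCardinality {A × B} (λ p → P (proj₁ p) × Q (proj₂ p)) (NP * NQ)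
HasCardinality-× {NQ = NQ} (L , unique , mem , len) countQ =
  subst (HasCardinality _) (trans (sum-const NQ L) (cong (_* NQ) len))
    (HasCardinality-bijection (λ p → p)
      (λ (a∈L , q) → to (mem _) a∈L , q)
      (λ _ _ same → same)
      (λ {p} (pa , q) → p , (from (mem (proj₁ p)) pa , q) , refl)
      (HasCardinality-Σ (λ _ → countQ) L unique))

InRange : ℕ → ℕ → ℕ → Set
InRange lo s x = lo ≤ x × x < lo + s

range-count : ∀ lo s → HasCardinality (InRange lo s) s
range-count lo s =
  HasCardinality-bijection (lo +_)
    (λ x<s → m≤m+n lo _ , +-monoʳ-< lo x<s)
    (λ _ _ → +-cancelˡ-≡ lo _ _)
    (λ {x} (lo≤x , x<lo+s) → x ∸ lo ,
       +-cancelˡ-< lo _ _ (subst (_< lo + s) (sym (m+[n∸m]≡n lo≤x)) x<lo+s) ,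
       m+[n∸m]≡n lo≤x)
    (upTo s , upTo⁺ s , (λ _ → mk⇔ ∈-upTo⁻ ∈-upTo⁺) , length-upTo s)

AllEntries : {A : Set} (P : A → Set) {len : ℕ} → Vec A len → Set
AllEntries P v = ∀ i → P (lookup v i)

vec-count : {A : Set} {P : A → Set} {s : ℕ} → HasCardinality P s →
  ∀ len → HasCardinality {Vec A len} (AllEntries P) (s ^ len)
vec-count count zero =
  [] ∷ [] , [] ∷ [] , (λ { [] → mk⇔ (λ _ ()) (λ _ → here refl) }) , refl
vec-count count (suc len) =
  HasCardinality-bijection (λ (x , xs) → x ∷ xs)
    (λ (px , pxs) → λ { fzero → px ; (fsuc i) → pxs i })
    (λ _ _ same → cong₂ _,_ (∷-injectiveˡ same) (∷-injectiveʳ same))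
    (λ { {x ∷ xs} all → (x , xs) , (all fzero , all ∘ fsuc) , refl })
    (HasCardinality-× count (vec-count count len))

≤ᵇ-true⇒≤ : ∀ {p q} → (p ≤ᵇ q) ≡ true → p ≤ q
≤ᵇ-true⇒≤ {p} {q} test = ≤ᵇ⇒≤ p q (from T-≡ test)

≤⇒≤ᵇ-true : ∀ {p q} → p ≤ q → (p ≤ᵇ q) ≡ true
≤⇒≤ᵇ-true p≤q = to T-≡ (≤⇒≤ᵇ p≤q)

≤ᵇ-suc : ∀ p q → (suc p ≤ᵇ suc q) ≡ (p ≤ᵇ q)
≤ᵇ-suc zero q = refl
≤ᵇ-suc (suc p) q = refl

-- An upward-closed Boolean predicate on the chain Fin n is a threshold test
-- y ↦ p ≤ y for some p ≤ n (p = n when it is nowhere true).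
upward-threshold : ∀ {n} (f : Fin n → Bool) →
  (∀ {y y'} → toℕ y ≤ toℕ y' → f y ≡ true → f y' ≡ true) →
  ∃[ p ] (p ≤ n × ∀ y → f y ≡ (p ≤ᵇ toℕ y))
upward-threshold {zero} f closed = 0 , z≤n , λ ()
upward-threshold {suc n} f closed with f fzero in f0
... | true = 0 , z≤n , λ y → closed z≤n f0
... | false with upward-threshold (f ∘ fsuc) (λ y≤y' → closed (s≤s y≤y'))
...   | p , p≤n , test =
  suc p , s≤s p≤n , λ { fzero → f0 ; (fsuc y) → trans (test y) (sym (≤ᵇ-suc p (toℕ y))) }

downward-threshold : ∀ {n} (g : Fin n → Bool) →
  (∀ {y y'} → toℕ y' ≤ toℕ y → g y ≡ true → g y' ≡ true) →
  ∃[ p ] (p ≤ n × ∀ y → g y ≡ (suc (toℕ y) ≤ᵇ p))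
downward-threshold {zero} g closed = 0 , z≤n , λ ()
downward-threshold {suc n} g closed with g fzero in g0
... | false = 0 , z≤n , nowhere
  where
  nowhere : ∀ y → g y ≡ false
  nowhere y with g y in gy
  ... | false = refl
  ... | true with trans (sym g0) (closed z≤n gy)
  ...   | ()
... | true with downward-threshold (g ∘ fsuc) (λ y'≤y → closed (s≤s y'≤y))
...   | p , p≤n , test = suc p , s≤s p≤n , λ { fzero → g0 ; (fsuc y) → test y }

upward-threshold-unique : ∀ {n p q} → p ≤ n → q ≤ n →
  (∀ (y : Fin n) → (p ≤ᵇ toℕ y) ≡ (q ≤ᵇ toℕ y)) → p ≡ q
upward-threshold-unique {zero} z≤n z≤n same = refl
upward-threshold-unique {suc n} {zero} {zero} _ _ same = refl
upward-threshold-unique {suc n} {zero} {suc q} _ _ same with same fzero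
... | ()
upward-threshold-unique {suc n} {suc p} {zero} _ _ same with same fzero
... | ()
upward-threshold-unique {suc n} {suc p} {suc q} (s≤s p≤n) (s≤s q≤n) same =
  cong suc (upward-threshold-unique p≤n q≤n λ y →
    trans (sym (≤ᵇ-suc p (toℕ y))) (trans (same (fsuc y)) (≤ᵇ-suc q (toℕ y))))

downward-threshold-unique : ∀ {n p q} → p ≤ n → q ≤ n →
  (∀ (y : Fin n) → (suc (toℕ y) ≤ᵇ p) ≡ (suc (toℕ y) ≤ᵇ q)) → p ≡ q
downward-threshold-unique {zero} z≤n z≤n same = refl
downward-threshold-unique {suc n} {zero} {zero} _ _ same = refl
downward-threshold-unique {suc n} {zero} {suc q} _ _ same with same fzero
... | ()
downward-threshold-unique {suc n} {suc p} {zero} _ _ same with same fzero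
... | ()
downward-threshold-unique {suc n} {suc p} {suc q} (s≤s p≤n) (s≤s q≤n) same =
  cong suc (downward-threshold-unique p≤n q≤n (same ∘ fsuc))

upset-≤ : ∀ {n p q} → p ≤ n → (∀ (y : Fin n) → q ≤ toℕ y → p ≤ toℕ y) → p ≤ q
upset-≤ {q = q} p≤n above = ≮⇒≥ λ q<p →
  let q<n = <-≤-trans q<p p≤n
      y≡q = toℕ-fromℕ< q<n
  in <⇒≱ q<p (subst (_ ≤_) y≡q (above (fromℕ< q<n) (≤-reflexive (sym y≡q))))

downset-≤ : ∀ {n p q} → p ≤ n → (∀ (y : Fin n) → toℕ y < p → toℕ y < q) → p ≤ q
downset-≤ p≤n below = upset-≤ p≤n λ y q≤y → ≮⇒≥ λ y<p → <⇒≱ (below y y<p) q≤y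

-- Threshold data for the star elements.  For the root s₀ = fzero and the
-- leaves sᵢ₊₁ = fsuc i:  base = low s₀,  mids = (up s₀, low s₁, …, low sₘ),
-- tops = (up s₁, …, up sₘ).
record Cut (m : ℕ) : Set where
  constructor cut
  field
    base : ℕ
    mids : Vec ℕ (suc m)
    tops : Vec ℕ m

open Cut

-- up x: first chain point above x;  low x: chain points below x are those < low x.
upAt : {m : ℕ} → Cut m → Fin (suc m) → ℕ
upAt c fzero = lookup (mids c) fzero
upAt c (fsuc i) = lookup (tops c) i

lowAt : {m : ℕ} → Cut m → Fin (suc m) → ℕ
lowAt c fzero = base c
lowAt c (fsuc i) = lookup (mids c) (fsuc i)

-- Validity: base is below every mid, every mid below every top, and all are ≤ n.
-- These are exactly the constraints transitivity and properness impose.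
record IsCut {m : ℕ} (n : ℕ) (c : Cut m) : Set where
  field
    base≤mids : ∀ x → base c ≤ lookup (mids c) x
    mids≤tops : ∀ x j → lookup (mids c) x ≤ lookup (tops c) j
    mids≤n : ∀ x → lookup (mids c) x ≤ n
    tops≤n : ∀ j → lookup (tops c) j ≤ n

  root-low : ∀ x → lowAt c fzero ≤ lowAt c x
  root-low fzero = ≤-refl
  root-low (fsuc i) = base≤mids (fsuc i)

  root-up : ∀ x → upAt c fzero ≤ upAt c x
  root-up fzero = ≤-refl
  root-up (fsuc j) = mids≤tops fzero j

  low≤leaf-up : ∀ z j → lowAt c z ≤ upAt c (fsuc j)
  low≤leaf-up fzero j = ≤-trans (base≤mids fzero) (mids≤tops fzero j)
  low≤leaf-up (fsuc i) j = mids≤tops (fsuc i) j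

  low≤up : ∀ x → lowAt c x ≤ upAt c x
  low≤up fzero = base≤mids fzero
  low≤up (fsuc j) = low≤leaf-up (fsuc j) j

  up≤n : ∀ x → upAt c x ≤ n
  up≤n fzero = mids≤n fzero
  up≤n (fsuc j) = tops≤n j

  low≤n : ∀ x → lowAt c x ≤ n
  low≤n x = ≤-trans (low≤up x) (up≤n x)

entry : {a b : ℕ} → Rel a b → Fin a → Fin b → Bool
entry M x y = lookup (lookup M x) y

tabulate² : {a b : ℕ} → (Fin a → Fin b → Bool) → Rel a b
tabulate² F = tabulate (λ x → tabulate (F x))

entry-tabulate² : ∀ {a b} (F : Fin a → Fin b → Bool) x y → entry (tabulate² F) x y ≡ F x y
entry-tabulate² F x y =
  trans (cong (λ row → lookup row y) (lookup∘tabulate (λ x → tabulate (F x)) x)) (lookup∘tabulate (F x) y)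

tabulate²-entry : ∀ {a b} (F : Fin a → Fin b → Bool) (M : Rel a b) →
  (∀ x y → F x y ≡ entry M x y) → tabulate² F ≡ M
tabulate²-entry F M same =
  trans (tabulate-cong λ x → trans (tabulate-cong (same x)) (tabulate∘lookup (lookup M x)))
        (tabulate∘lookup M)

above? : {m n : ℕ} → Cut m → Fin (suc m) → Fin n → Bool
above? c x y = upAt c x ≤ᵇ toℕ y

below? : {m n : ℕ} → Cut m → Fin n → Fin (suc m) → Bool
below? c y x = suc (toℕ y) ≤ᵇ lowAt c x

encode : {m : ℕ} (n : ℕ) → Cut m → Rel (suc m) n × Rel n (suc m)
encode n c = tabulate² (above? c) , tabulate² (below? c)

module _ {m n : ℕ} (c : Cut m) where

  encode-R⁻ : ∀ x y → proj₁ (encode n c) ∋⟨ x , y ⟩ → upAt c x ≤ toℕ y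
  encode-R⁻ x y xRy = ≤ᵇ-true⇒≤ (trans (sym (entry-tabulate² (above? c) x y)) xRy)

  encode-R⁺ : ∀ x y → upAt c x ≤ toℕ y → proj₁ (encode n c) ∋⟨ x , y ⟩
  encode-R⁺ x y up≤y = trans (entry-tabulate² (above? c) x y) (≤⇒≤ᵇ-true up≤y)

  encode-T⁻ : ∀ y x → proj₂ (encode n c) ∋⟨ y , x ⟩ → toℕ y < lowAt c x
  encode-T⁻ y x yTx = ≤ᵇ-true⇒≤ (trans (sym (entry-tabulate² (below? c) y x)) yTx)

  encode-T⁺ : ∀ y x → toℕ y < lowAt c x → proj₂ (encode n c) ∋⟨ y , x ⟩
  encode-T⁺ y x y<low = trans (entry-tabulate² (below? c) y x) (≤⇒≤ᵇ-true y<low)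

encode-proper : ∀ {m n} {c : Cut m} → IsCut n c → IsProperMerging (encode n c)
encode-proper {m} {n} {c} valid = (reflexive , transitive) , irreflexive
  where
  open IsCut valid
  R = proj₁ (encode n c)
  T = proj₂ (encode n c)

  reflexive : (x : Elem m n) → ≤[ R , T ] x x
  reflexive (inj₁ x) = inj₁ refl
  reflexive (inj₂ y) = ≤-refl

  transitive : (x y z : Elem m n) → ≤[ R , T ] x y → ≤[ R , T ] y z → ≤[ R , T ] x z
  transitive (inj₁ x) (inj₁ y) (inj₁ z) (inj₁ refl) y≤z = y≤z
  transitive (inj₁ x) (inj₁ y) (inj₁ z) (inj₂ refl) _ = inj₂ refl
  transitive (inj₁ x) (inj₁ y) (inj₂ z) (inj₁ refl) yRz = yRz
  transitive (inj₁ x) (inj₁ y) (inj₂ z) (inj₂ refl) yRz =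
    encode-R⁺ c fzero z (≤-trans (root-up y) (encode-R⁻ c y z yRz))
  transitive (inj₁ fzero) (inj₂ y) (inj₁ z) _ _ = inj₂ refl
  transitive (inj₁ (fsuc j)) (inj₂ y) (inj₁ z) xRy yTz =
    ⊥-elim (<⇒≱ (encode-T⁻ c y z yTz) (≤-trans (low≤leaf-up z j) (encode-R⁻ c (fsuc j) y xRy)))
  transitive (inj₁ x) (inj₂ y) (inj₂ z) xRy y≤z = encode-R⁺ c x z (≤-trans (encode-R⁻ c x y xRy) y≤z)
  transitive (inj₂ x) (inj₁ y) (inj₁ z) xTy (inj₁ refl) = xTy
  transitive (inj₂ x) (inj₁ y) (inj₁ z) xTy (inj₂ refl) =
    encode-T⁺ c x z (<-≤-trans (encode-T⁻ c x fzero xTy) (root-low z))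
  transitive (inj₂ x) (inj₁ y) (inj₂ z) xTy yRz =
    <⇒≤ (<-≤-trans (encode-T⁻ c x y xTy) (≤-trans (low≤up y) (encode-R⁻ c y z yRz)))
  transitive (inj₂ x) (inj₂ y) (inj₁ z) x≤y yTz = encode-T⁺ c x z (≤-<-trans x≤y (encode-T⁻ c y z yTz))
  transitive (inj₂ x) (inj₂ y) (inj₂ z) x≤y y≤z = ≤-trans x≤y y≤z

  irreflexive : (x : Fin (suc m)) (y : Fin n) → ¬ (R ∋⟨ x , y ⟩ × T ∋⟨ y , x ⟩)
  irreflexive x y (xRy , yTx) = <⇒≱ (encode-T⁻ c y x yTx) (≤-trans (low≤up x) (encode-R⁻ c x y xRy))

-- Each inequality is read off by
-- comparing the up- and downsets on the chain that R and T single out.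
module _ {m n : ℕ} (c : Cut m) (up≤n : ∀ x → upAt c x ≤ n) (low≤n : ∀ x → lowAt c x ≤ n)
         (proper : IsProperMerging (encode n c)) where

  private
    transitive = proj₂ (proj₁ proper)
    irreflexive = proj₂ proper

    -- the root lies below every star element
    root-up : ∀ x → upAt c fzero ≤ upAt c x
    root-up x = upset-≤ (up≤n fzero) λ y up≤y →
      encode-R⁻ c fzero y (transitive (inj₁ fzero) (inj₁ x) (inj₂ y) (inj₂ refl) (encode-R⁺ c x y up≤y))

    root-low : ∀ x → lowAt c fzero ≤ lowAt c x
    root-low x = downset-≤ (low≤n fzero) λ y y<low →
      encode-T⁻ c y x (transitive (inj₂ y) (inj₁ fzero) (inj₁ x) (encode-T⁺ c y fzero y<low) (inj₂ refl))

    -- no chain point is both above and below x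
    low≤up : ∀ x → lowAt c x ≤ upAt c x
    low≤up x = downset-≤ (low≤n x) λ y y<low → ≰⇒> λ up≤y →
      irreflexive x y (encode-R⁺ c x y up≤y , encode-T⁺ c y x y<low)

    -- a leaf is comparable to no other star element, so nothing below z is above it
    low≤leaf-up : ∀ z j → lowAt c z ≤ upAt c (fsuc j)
    low≤leaf-up z j = downset-≤ (low≤n z) λ y y<low → ≰⇒> λ up≤y →
      leaf-isolated y (encode-R⁺ c (fsuc j) y up≤y) (encode-T⁺ c y z y<low)
      where
      leaf-isolated : ∀ y → proj₁ (encode n c) ∋⟨ fsuc j , y ⟩ → proj₂ (encode n c) ∋⟨ y , z ⟩ → ⊥
      leaf-isolated y jRy yTz with transitive (inj₁ (fsuc j)) (inj₂ y) (inj₁ z) jRy yTz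
      ... | inj₁ refl = irreflexive (fsuc j) y (jRy , yTz)

  proper⇒IsCut : IsCut n c
  proper⇒IsCut = record
    { base≤mids = λ { fzero → low≤up fzero ; (fsuc i) → root-low (fsuc i) }
    ; mids≤tops = λ { fzero j → root-up (fsuc j) ; (fsuc i) j → low≤leaf-up (fsuc i) j }
    ; mids≤n = λ { fzero → up≤n fzero ; (fsuc i) → low≤n (fsuc i) }
    ; tops≤n = λ j → up≤n (fsuc j)
    }

cutFrom : {m : ℕ} → (low up : Fin (suc m) → ℕ) → Cut m
cutFrom low up = cut (low fzero) (up fzero ∷ tabulate (low ∘ fsuc)) (tabulate (up ∘ fsuc))

upAt-cutFrom : ∀ {m} (low up : Fin (suc m) → ℕ) x → upAt (cutFrom low up) x ≡ up x
upAt-cutFrom low up fzero = refl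
upAt-cutFrom low up (fsuc j) = lookup∘tabulate (up ∘ fsuc) j

lowAt-cutFrom : ∀ {m} (low up : Fin (suc m) → ℕ) x → lowAt (cutFrom low up) x ≡ low x
lowAt-cutFrom low up fzero = refl
lowAt-cutFrom low up (fsuc i) = lookup∘tabulate (low ∘ fsuc) i

-- Completeness, part 2: in a merging, rows of R are upsets and columns of T
-- downsets of the chain, so (R , T) is described by thresholds in [0, n].
merging-thresholds : ∀ {m n} (R : Rel (suc m) n) (T : Rel n (suc m)) → IsMerging R T →
  ∃[ c ] ((∀ x → upAt c x ≤ n) × (∀ x → lowAt c x ≤ n) × encode n c ≡ (R , T))
merging-thresholds {m} {n} R T (_ , transitive) =
  cutFrom low up ,
  (λ x → subst (_≤ n) (sym (upAt-cutFrom low up x)) (proj₁ (proj₂ (row x)))) ,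
  (λ x → subst (_≤ n) (sym (lowAt-cutFrom low up x)) (proj₁ (proj₂ (column x)))) ,
  cong₂ _,_
    (tabulate²-entry _ R λ x y →
      trans (cong (_≤ᵇ toℕ y) (upAt-cutFrom low up x)) (sym (proj₂ (proj₂ (row x)) y)))
    (tabulate²-entry _ T λ y x →
      trans (cong (suc (toℕ y) ≤ᵇ_) (lowAt-cutFrom low up x)) (sym (proj₂ (proj₂ (column x)) y)))
  where
  row : ∀ x → ∃[ p ] (p ≤ n × ∀ y → entry R x y ≡ (p ≤ᵇ toℕ y))
  row x = upward-threshold (entry R x) λ y≤y' xRy → transitive (inj₁ x) (inj₂ _) (inj₂ _) xRy y≤y'

  column : ∀ x → ∃[ p ] (p ≤ n × ∀ y → entry T y x ≡ (suc (toℕ y) ≤ᵇ p))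
  column x = downward-threshold (λ y → entry T y x) λ y'≤y yTx → transitive (inj₂ _) (inj₂ _) (inj₁ x) y'≤y yTx

  up low : Fin (suc m) → ℕ
  up x = proj₁ (row x)
  low x = proj₁ (column x)

decode : ∀ {m n} {M : Rel (suc m) n × Rel n (suc m)} → IsProperMerging M → ∃[ c ] (IsCut n c × encode n c ≡ M)
decode {M = R , T} proper with merging-thresholds R T (proj₁ proper)
... | c , up≤n , low≤n , describes =
  c , proper⇒IsCut c up≤n low≤n (subst IsProperMerging (sym describes) proper) , describes

vec-ext : ∀ {A : Set} {k} (u v : Vec A k) → (∀ i → lookup u i ≡ lookup v i) → u ≡ v
vec-ext u v same = trans (sym (tabulate∘lookup u)) (trans (tabulate-cong same) (tabulate∘lookup v))

cut-ext : ∀ {m} {c c' : Cut m} → (∀ x → lowAt c x ≡ lowAt c' x) → (∀ x → upAt c x ≡ upAt c' x) → c ≡ c'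
cut-ext {c = cut b ms ts} {cut b' ms' ts'} same-low same-up
  with same-low fzero
     | vec-ext ms ms' (λ { fzero → same-up fzero ; (fsuc i) → same-low (fsuc i) })
     | vec-ext ts ts' (same-up ∘ fsuc)
... | refl | refl | refl = refl

encode-injective : ∀ {m n} {c c' : Cut m} → IsCut n c → IsCut n c' → encode n c ≡ encode n c' → c ≡ c'
encode-injective {n = n} {c} {c'} valid valid' same = cut-ext same-low same-up
  where
  same-up : ∀ x → upAt c x ≡ upAt c' x
  same-up x = upward-threshold-unique (IsCut.up≤n valid x) (IsCut.up≤n valid' x) λ y →
    trans (sym (entry-tabulate² (above? c) x y))
      (trans (cong (λ M → entry (proj₁ M) x y) same) (entry-tabulate² (above? c') x y))

  same-low : ∀ x → lowAt c x ≡ lowAt c' x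
  same-low x = downward-threshold-unique (IsCut.low≤n valid x) (IsCut.low≤n valid' x) λ y →
    trans (sym (entry-tabulate² (below? c) y x))
      (trans (cong (λ M → entry (proj₂ M) y x) same) (entry-tabulate² (below? c') y x))

maxV : {k : ℕ} → Vec ℕ k → ℕ
maxV [] = 0
maxV (x ∷ xs) = x ⊔ maxV xs

maxV-upper : ∀ {k} (v : Vec ℕ k) i → lookup v i ≤ maxV v
maxV-upper (x ∷ xs) fzero = m≤m⊔n x (maxV xs)
maxV-upper (x ∷ xs) (fsuc i) = ≤-trans (maxV-upper xs i) (m≤n⊔m x (maxV xs))

maxV-least : ∀ {k} (v : Vec ℕ k) {b} → (∀ i → lookup v i ≤ b) → maxV v ≤ b
maxV-least [] bound = z≤n
maxV-least (x ∷ xs) bound = ⊔-lub (bound fzero) (maxV-least xs (bound ∘ fsuc))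

maxV-shift : ∀ {k} a (v : Vec ℕ (suc k)) → maxV (vmap (_+ a) v) ≡ maxV v + a
maxV-shift a (x ∷ []) = trans (⊔-identityʳ (x + a)) (cong (_+ a) (sym (⊔-identityʳ x)))
maxV-shift a (x ∷ y ∷ ys) =
  trans (cong ((x + a) ⊔_) (maxV-shift a (y ∷ ys))) (sym (+-distribʳ-⊔ a x (maxV (y ∷ ys))))

shift-up-down : ∀ {k} a (v : Vec ℕ k) → vmap (_∸ a) (vmap (_+ a) v) ≡ v
shift-up-down a [] = refl
shift-up-down a (x ∷ xs) = cong₂ _∷_ (m+n∸n≡m x a) (shift-up-down a xs)

shift-down-up : ∀ {k} a (v : Vec ℕ k) → (∀ i → a ≤ lookup v i) → vmap (_+ a) (vmap (_∸ a) v) ≡ v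
shift-down-up a [] _ = refl
shift-down-up a (x ∷ xs) a≤v = cong₂ _∷_ (m∸n+n≡m (a≤v fzero)) (shift-down-up a xs (a≤v ∘ fsuc))

levels : ℕ → List ℕ
levels n = map suc (upTo (suc n))

levels-unique : ∀ n → Unique (levels n)
levels-unique n = unique-map⁺ suc-injective (upTo⁺ (suc n))

∈-levels⁻ : ∀ {n k} → k ∈ levels n → 1 ≤ k × k ≤ suc n
∈-levels⁻ k∈ with ∈-map⁻ suc k∈
... | j , j∈ , refl = s≤s z≤n , ∈-upTo⁻ j∈

∈-levels⁺ : ∀ {n k} → 1 ≤ k → k ≤ suc n → k ∈ levels n
∈-levels⁺ {k = suc j} _ k≤ = ∈-map⁺ suc (∈-upTo⁺ k≤)

peak : ℕ → ℕ → ℕ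
peak n k = suc n ∸ k

peak+level : ∀ {n k} → k ≤ suc n → peak n k + k ≡ suc n
peak+level = m∸n+n≡m

level-width : ∀ {n k} → k ≤ suc n → n + 2 ∸ k ≡ suc (peak n k)
level-width {n} {k} k≤ = trans (cong (_∸ k) (+-comm n 2)) (+-∸-assoc 1 k≤)

peak≤n : ∀ {n k} → 1 ≤ k → peak n k ≤ n
peak≤n {n} 1≤k = ∸-monoʳ-≤ (suc n) 1≤k

level-of-peak : ∀ {n t} → t ≤ n → peak n t ∈ levels n × peak n (peak n t) ≡ t
level-of-peak {n} {t} t≤n =
  ∈-levels⁺ (m<n⇒0<n∸m (s≤s t≤n)) (m∸n≤m (suc n) t) , m∸[m∸n]≡n (m≤n⇒m≤1+n t≤n)

peak-of-level : ∀ {n k} → k ≤ suc n → peak n (peak n k) ≡ k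
peak-of-level = m∸[m∸n]≡n

-- Parameters of a cut: a level k, the tops, and the offsets mids ∸ base.
Param : ℕ → Set
Param m = ℕ × Vec ℕ m × Vec ℕ (suc m)

-- Admissible parameters at level k: tops in [peak, n], offsets in [0, peak].
Fits : (m n k : ℕ) → Vec ℕ m × Vec ℕ (suc m) → Set
Fits m n k (ts , offsets) = AllEntries (InRange (peak n k) k) ts × AllEntries (InRange 0 (n + 2 ∸ k)) offsets

IsParam : (m n : ℕ) → Param m → Set
IsParam m n p = proj₁ p ∈ levels n × Fits m n (proj₁ p) (proj₂ p)

param-count : ∀ m n → HasCardinality (IsParam m n) (starChainFormula m n)
param-count m n =
  HasCardinality-Σ
    (λ k → HasCardinality-× (vec-count (range-count (peak n k) k) m)
                              (vec-count (range-count 0 (n + 2 ∸ k)) (suc m)))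
    (levels n) (levels-unique n)

-- From parameters to a cut: the base is chosen so that the largest mid is the peak.
fromParam : {m : ℕ} (n : ℕ) → Param m → Cut m
fromParam n (k , ts , offsets) = cut b (vmap (_+ b) offsets) ts
  where
  b = peak n k ∸ maxV offsets

toParam : {m : ℕ} (n : ℕ) → Cut m → Param m
toParam n c = peak n (maxV (mids c)) , tops c , vmap (_∸ base c) (mids c)

offsets-below-peak : ∀ {m n k} (offsets : Vec ℕ (suc m)) → k ≤ suc n →
  AllEntries (InRange 0 (n + 2 ∸ k)) offsets → maxV offsets + (peak n k ∸ maxV offsets) ≡ peak n k
offsets-below-peak offsets k≤ offsets-fit =
  m+[n∸m]≡n (maxV-least offsets λ x → ≤-pred (subst (lookup offsets x <_) (level-width k≤) (proj₂ (offsets-fit x))))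

fromParam-valid : ∀ {m n} (p : Param m) → IsParam m n p → IsCut n (fromParam n p)
fromParam-valid {n = n} (k , ts , offsets) (k∈ , ts-fit , offsets-fit) = record
  { base≤mids = λ x → subst (b ≤_) (sym (lookup-map x (_+ b) offsets)) (m≤n+m b _)
  ; mids≤tops = λ x j → ≤-trans (mid≤peak x) (proj₁ (ts-fit j))
  ; mids≤n = λ x → ≤-trans (mid≤peak x) (peak≤n (proj₁ (∈-levels⁻ k∈)))
  ; tops≤n = λ j → ≤-pred (subst (lookup ts j <_) (peak+level k≤) (proj₂ (ts-fit j)))
  }
  where
  open ≤-Reasoning
  k≤ = proj₂ (∈-levels⁻ k∈)
  b = peak n k ∸ maxV offsets

  mid≤peak : ∀ x → lookup (vmap (_+ b) offsets) x ≤ peak n k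
  mid≤peak x = begin
    lookup (vmap (_+ b) offsets) x ≡⟨ lookup-map x (_+ b) offsets ⟩
    lookup offsets x + b           ≤⟨ +-monoˡ-≤ b (maxV-upper offsets x) ⟩
    maxV offsets + b               ≡⟨ offsets-below-peak offsets k≤ offsets-fit ⟩
    peak n k                       ∎

toParam-fromParam : ∀ {m n} (p : Param m) → IsParam m n p → toParam n (fromParam n p) ≡ p
toParam-fromParam {n = n} (k , ts , offsets) (k∈ , _ , offsets-fit) =
  cong₂ _,_ level-back (cong (ts ,_) (shift-up-down b offsets))
  where
  open ≡-Reasoning
  k≤ = proj₂ (∈-levels⁻ k∈)
  b = peak n k ∸ maxV offsets

  level-back : peak n (maxV (vmap (_+ b) offsets)) ≡ k
  level-back = begin
    peak n (maxV (vmap (_+ b) offsets)) ≡⟨ cong (peak n) (maxV-shift b offsets) ⟩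
    peak n (maxV offsets + b)           ≡⟨ cong (peak n) (offsets-below-peak offsets k≤ offsets-fit) ⟩
    peak n (peak n k)                   ≡⟨ peak-of-level k≤ ⟩
    k                                   ∎

toParam-valid : ∀ {m n} (c : Cut m) → IsCut n c → IsParam m n (toParam n c)
toParam-valid {n = n} c valid = level∈ , tops-fit , offsets-fit
  where
  open IsCut valid
  t = maxV (mids c)
  level∈ = proj₁ (level-of-peak (maxV-least (mids c) mids≤n))
  peak≡t = proj₂ (level-of-peak (maxV-least (mids c) mids≤n))
  k≤ = proj₂ (∈-levels⁻ level∈)

  tops-fit : AllEntries (InRange (peak n (peak n t)) (peak n t)) (tops c)
  tops-fit j =
    subst (_≤ lookup (tops c) j) (sym peak≡t) (maxV-least (mids c) λ x → mids≤tops x j) ,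
    subst (lookup (tops c) j <_) (sym (peak+level k≤)) (s≤s (tops≤n j))

  offsets = vmap (_∸ base c) (mids c)

  offsets-fit : AllEntries (InRange 0 (n + 2 ∸ peak n t)) offsets
  offsets-fit x =
    z≤n ,
    subst (lookup offsets x <_) (sym (trans (level-width k≤) (cong suc peak≡t)))
      (s≤s (subst (_≤ t) (sym (lookup-map x (_∸ base c) (mids c)))
        (≤-trans (m∸n≤m (lookup (mids c) x) (base c)) (maxV-upper (mids c) x))))

fromParam-toParam : ∀ {m n} (c : Cut m) → IsCut n c → fromParam n (toParam n c) ≡ c
fromParam-toParam {n = n} c valid =
  trans (cong (λ b → cut b (vmap (_+ b) offsets) (tops c)) base-back)
        (cong (λ v → cut (base c) v (tops c)) (shift-down-up (base c) (mids c) base≤mids))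
  where
  open IsCut valid
  open ≡-Reasoning
  t = maxV (mids c)
  offsets = vmap (_∸ base c) (mids c)

  maxV-offsets : maxV offsets + base c ≡ t
  maxV-offsets = begin
    maxV offsets + base c           ≡⟨ sym (maxV-shift (base c) offsets) ⟩
    maxV (vmap (_+ base c) offsets) ≡⟨ cong maxV (shift-down-up (base c) (mids c) base≤mids) ⟩
    t                               ∎

  base-back : peak n (peak n t) ∸ maxV offsets ≡ base c
  base-back = begin
    peak n (peak n t) ∸ maxV offsets ≡⟨ cong (_∸ maxV offsets) (proj₂ (level-of-peak (maxV-least (mids c) mids≤n))) ⟩
    t ∸ maxV offsets                 ≡⟨ cong (t ∸_) (trans (sym (m+n∸n≡m (maxV offsets) (base c))) (cong (_∸ base c) maxV-offsets)) ⟩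
    t ∸ (t ∸ base c)                 ≡⟨ m∸[m∸n]≡n (≤-trans (base≤mids fzero) (maxV-upper (mids c) fzero)) ⟩
    base c                           ∎

cut-count : ∀ m n → HasCardinality {Cut m} (IsCut n) (starChainFormula m n)
cut-count m n =
  HasCardinality-bijection (fromParam n) (fromParam-valid _)
    (λ {p} {p'} ok ok' same →
      trans (sym (toParam-fromParam p ok)) (trans (cong (toParam n) same) (toParam-fromParam p' ok')))
    (λ {c} valid → toParam n c , toParam-valid c valid , fromParam-toParam c valid)
    (param-count m n)

-- Main theorem.  The count holds for every m.
theorem1p1 : (m n : ℕ) → 1 ≤ m →
    HasCardinality {Rel (suc m) n × Rel n (suc m)} IsProperMerging (starChainFormula m n)
theorem1p1 m n _ =
  HasCardinality-bijection (encode n) encode-proper encode-injective decode (cut-count m n)
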